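{- The following algorithm for Brouwerian difference is correct: on input lists $M$ and $S$ its successive calls to next return, each exactly once, precisely the intervals of $M-S$, and then $\text{null}$. Algorithm: keep a current interval $[\ell'\..r']$ of $S$, initially $[-\infty\..-\infty]$. next: while $M$ is not exhausted do \{ $[\ell\..r]\leftarrow$ next$(M)$; while $\ell'<\ell$ and $r'<r$ and $S$ is not exhausted do $[\ell'\..r']\leftarrow$ next$(S)$; if $S$ is exhausted or $[\ell'\..r']\not\subseteq[\ell\..r]$ then return $[\ell\..r]$ \}; return $\text{null}$.
   Context: Let $O$ be a finite totally ordered set accessed only via comparisons; $\pm\infty$ denote special elements strictly smaller/larger than every element of $O$. A subset $X\subseteq O$ is an interval if $x,y\in X$, $x<z<y$ imply $z\in X$; nonempty intervals are written $[\ell\..r]$. An antichain of intervals is a set of intervals pairwise incomparable under inclusion, listed in natural order (by left extreme, equivalently right extreme). The input consists of two lists $M$ (minuend) and $S$ (subtrahend), each a nonempty antichain of nonempty intervals delivered in natural order via a next function returning $\text{null}$ once exhausted. The Brouwerian difference $M-S$ is the set of intervals $I\in M$ for which there is no $J\in S$ with $J\subseteq I$. -}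

module Defs where

open import Data.Product using (Σ; ∃; _×_; _,_; proj₁; proj₂)
open import Data.Sum using (_⊎_)
open import Data.Maybe using (Maybe; just; nothing)
open import Data.List using (List; []; _∷_)
open import Data.List.Membership.Propositional using (_∈_)
open import Data.List.Relation.Unary.All using (All)
open import Data.List.Relation.Unary.AllPairs using (AllPairs)
open import Relation.Nullary using (¬_; yes; no)
open import Relation.Binary.PropositionalEquality using (_≡_)
open import Relation.Binary.Structures using (IsStrictTotalOrder)
open import Relation.Binary.Definitions using (tri<; tri≈; tri>)

record Interval (A : Set) : Set where
  constructor [_∙∙_]
  field
    left  : A
    right : A
open Interval public

-- Extended elements: -∞ and +∞ are strictly below/above every element of O.
data Ext (A : Set) : Set where
  -∞  : Ext A
  fin : A → Ext A
  +∞  : Ext A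

Finite : Set → Set
Finite A = Σ (List A) λ xs → ∀ (x : A) → x ∈ xs

module Alg {A : Set} (_<_ : A → A → Set)
           (sto : IsStrictTotalOrder _≡_ _<_) where

  open IsStrictTotalOrder sto using (compare)

  _≤_ : A → A → Set
  x ≤ y = (x < y) ⊎ (x ≡ y)

  _∈I_ : A → Interval A → Set
  z ∈I I = (left I ≤ z) × (z ≤ right I)

  Nonempty : Interval A → Set
  Nonempty I = ∃ λ z → z ∈I I

  _⊆I_ : Interval A → Interval A → Set
  I ⊆I J = ∀ z → z ∈I I → z ∈I J

  IsAntichain : List (Interval A) → Set
  IsAntichain xs =
      All Nonempty xs
    × AllPairs (λ I J → (¬ (I ⊆I J)) × (¬ (J ⊆I I))) xs
    × AllPairs (λ I J → left I < left J) xs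

  _∈Diff_,_ : Interval A → List (Interval A) → List (Interval A) → Set
  I ∈Diff M , S = (I ∈ M) × (¬ (∃ λ J → (J ∈ S) × (J ⊆I I)))

  data B : Set where tt ff : B

  _&_ : B → B → B
  tt & b = b
  ff & _ = ff

  lt : A → A → B
  lt x y with compare x y
  ... | tri< _ _ _ = tt
  ... | tri≈ _ _ _ = ff
  ... | tri> _ _ _ = ff

  not : B → B
  not tt = ff
  not ff = tt

  ltE : Ext A → A → B
  ltE -∞ _ = tt
  ltE (fin x) y = lt x y
  ltE +∞ _ = ff

  leE : A → Ext A → B
  leE _ -∞ = ff
  leE x (fin y) = not (lt y x)
  leE _ +∞ = tt

  -- current interval of S: nothing means "S is exhausted" (next(S)
  -- returned null); otherwise the current [ℓ'..r'] with extended extremes.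
  Cur : Set
  Cur = Maybe (Ext A × Ext A)

  finI : Interval A → Cur
  finI J = just (fin (left J) , fin (right J))

  record State : Set where
    constructor st
    field
      restM : List (Interval A)
      cur   : Cur
      restS : List (Interval A)

  initState : List (Interval A) → List (Interval A) → State
  initState M S = st M (just (-∞ , -∞)) S

  -- while ℓ' < ℓ and r' < r and S is not exhausted do [ℓ'..r'] ← next(S)
  advance : A → A → Cur → List (Interval A) → Cur × List (Interval A)
  advance ℓ r nothing rs = nothing , rs
  advance ℓ r (just (ℓ' , r')) rs with ltE ℓ' ℓ & ltE r' r
  ... | ff = just (ℓ' , r') , rs
  advance ℓ r (just (ℓ' , r')) [] | tt = nothing , []
  advance ℓ r (just (ℓ' , r')) (J ∷ rs) | tt = advance ℓ r (finI J) rs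

  incl : Cur → A → A → B
  incl nothing _ _ = ff
  incl (just (ℓ' , r')) ℓ r = leE ℓ ℓ' & leE' r' r
    where
      leE' : Ext A → A → B
      leE' -∞ _ = tt
      leE' (fin x) y = not (lt y x)
      leE' +∞ _ = ff

  exhausted : Cur → B
  exhausted nothing = tt
  exhausted (just _) = ff

  -- the body of the outer loop after [ℓ..r] ← next(M) and the inner loop
  decide : Interval A → B → B → State → Maybe (Interval A × State) →
           Maybe (Interval A × State)
  decide I tt _  s _    = just (I , s)
  decide I ff ff s _    = just (I , s)
  decide I ff tt _ rest = rest

  nextL : List (Interval A) → Cur → List (Interval A) →
          Maybe (Interval A × State)
  nextL [] c rs = nothing
  nextL (I ∷ ms) c rs =
    let c'  = proj₁ (advance (left I) (right I) c rs)
        rs' = proj₂ (advance (left I) (right I) c rs)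
    in decide I (exhausted c') (incl c' (left I) (right I))
              (st ms c' rs') (nextL ms c' rs')

  -- one call of next; nothing = null
  next : State → Maybe (Interval A × State)
  next (st ms c rs) = nextL ms c rs

  data Returns : State → List (Interval A) → Set where
    stop : ∀ {s} → next s ≡ nothing → Returns s []
    step : ∀ {s s' I Is} → next s ≡ just (I , s') → Returns s' Is →
           Returns s (I ∷ Is)

-- Antichains in natural order are strictly increasing in both extremes. The
-- algorithm maintains a suffix R of S containing every J ∈ S that lies inside an unread interval of M:
-- the inner loop only discards intervals starting before ℓ, hence before every
-- later interval of M. When the inner loop stops at K, we have ¬ (ℓ' < ℓ and
-- r' < r); if moreover K ⊈ [ℓ..r], then r ≤ r', so every later interval of S
-- ends beyond r. Hence [ℓ..r] contains some J ∈ S iff it contains K, which is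
-- exactly the test the algorithm performs.
module Submission where

open import Defs
open import Data.Product using (Σ; ∃; _×_; _,_; proj₁; proj₂)
open import Data.Sum using (_⊎_; inj₁; inj₂; [_,_]′)
open import Data.Unit using (⊤)
open import Data.Empty using (⊥-elim)
open import Data.Maybe using (Maybe; just; nothing)
open import Data.List using (List; []; _∷_; drop)
open import Data.List.Membership.Propositional using (_∈_)
open import Data.List.Relation.Unary.Any using (here; there)
open import Data.List.Relation.Unary.Any.Properties using (¬Any[])
open import Data.List.Relation.Unary.All as All using (All; _∷_)
open import Data.List.Relation.Unary.AllPairs using (AllPairs; []; _∷_)
open import Data.List.Relation.Unary.Unique.Propositional using (Unique)
open import Relation.Nullary using (¬_)
open import Relation.Binary.PropositionalEquality
  using (_≡_; _≢_; refl; sym; trans; cong; isEquivalence)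
open import Relation.Binary.Structures using (IsStrictTotalOrder)
open import Relation.Binary.Definitions using (tri<; tri≈; tri>)
open import Function.Bundles using (_⇔_; mk⇔; Equivalence)
import Relation.Binary.Construct.StrictToNonStrict as NonStrict

module BrouwerianDifference {A : Set} (_<_ : A → A → Set)
                            (sto : IsStrictTotalOrder _≡_ _<_) where

  open Alg _<_ sto
  open IsStrictTotalOrder sto
    using (compare; irrefl; <-resp-≈; <-respʳ-≈; <-respˡ-≈) renaming (trans to <-trans)

  ≤-trans : ∀ {x y z} → x ≤ y → y ≤ z → x ≤ z
  ≤-trans = NonStrict.trans _≡_ _<_ isEquivalence <-resp-≈ <-trans

  <-≤-trans : ∀ {x y z} → x < y → y ≤ z → x < z
  <-≤-trans = NonStrict.<-≤-trans _≡_ _<_ <-trans <-respʳ-≈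

  ≤-<-trans : ∀ {x y z} → x ≤ y → y < z → x < z
  ≤-<-trans = NonStrict.≤-<-trans _≡_ _<_ sym <-trans <-respˡ-≈

  <⇒≱ : ∀ {x y} → x < y → ¬ (y ≤ x)
  <⇒≱ x<y y≤x = irrefl refl (<-≤-trans x<y y≤x)

  ≮⇒≥ : ∀ {x y} → ¬ (x < y) → y ≤ x
  ≮⇒≥ {x} {y} x≮y with compare x y
  ... | tri< x<y _ _ = ⊥-elim (x≮y x<y)
  ... | tri≈ _ x≡y _ = inj₂ (sym x≡y)
  ... | tri> _ _ y<x = inj₁ y<x

  ⊆I⇒bounds : ∀ {J I} → Nonempty J → J ⊆I I → left I ≤ left J × right J ≤ right I
  ⊆I⇒bounds {J} (z , ℓ≤z , z≤r) J⊆I =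
    proj₁ (J⊆I (left J) (inj₂ refl , ≤-trans ℓ≤z z≤r)) ,
    proj₂ (J⊆I (right J) (≤-trans ℓ≤z z≤r , inj₂ refl))

  bounds⇒⊆I : ∀ {J I} → left I ≤ left J → right J ≤ right I → J ⊆I I
  bounds⇒⊆I ℓ≤ℓ′ r′≤r z (ℓ′≤z , z≤r′) = ≤-trans ℓ≤ℓ′ ℓ′≤z , ≤-trans z≤r′ r′≤r

  _≺_ : Interval A → Interval A → Set
  K ≺ I = (left K < left I) × (right K < right I)

  Increasing : List (Interval A) → Set
  Increasing = AllPairs _≺_

  antichain⇒increasing : ∀ {xs} → IsAntichain xs → Increasing xs
  antichain⇒increasing (_ , [] , []) = []
  antichain⇒increasing (_ ∷ ne , inc ∷ incs , asc ∷ ascs) =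
    All.zipWith ≺-of (inc , asc) ∷ antichain⇒increasing (ne , incs , ascs)
    where
    ≺-of : ∀ {I J} → ((¬ I ⊆I J) × (¬ J ⊆I I)) × (left I < left J) → I ≺ J
    ≺-of {I} {J} ((_ , J⊈I) , ℓ<ℓ′) with compare (right I) (right J)
    ... | tri< r<r′ _ _ = ℓ<ℓ′ , r<r′
    ... | tri≈ _ r≡r′ _ = ⊥-elim (J⊈I (bounds⇒⊆I (inj₁ ℓ<ℓ′) (inj₂ (sym r≡r′))))
    ... | tri> _ _ r′<r = ⊥-elim (J⊈I (bounds⇒⊆I (inj₁ ℓ<ℓ′) (inj₁ r′<r)))

  ¬≺-⊈⇒right≤ : ∀ {K I} → Nonempty K → ¬ K ≺ I → ¬ K ⊆I I → right I ≤ right K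
  ¬≺-⊈⇒right≤ {K} {I} _ K⊀I K⊈I with compare (right K) (right I)
  ... | tri< r′<r _ _ = ⊥-elim (K⊈I (bounds⇒⊆I (≮⇒≥ (λ ℓ′<ℓ → K⊀I (ℓ′<ℓ , r′<r))) (inj₁ r′<r)))
  ... | tri≈ _ r′≡r _ = inj₂ (sym r′≡r)
  ... | tri> _ _ r<r′ = inj₁ r<r′

  data Reflects (P : Set) : B → Set where
    ofᵗ : P → Reflects P tt
    ofᶠ : ¬ P → Reflects P ff

  Reflects-map : ∀ {P Q b} → (P → Q) → (Q → P) → Reflects P b → Reflects Q b
  Reflects-map f g (ofᵗ p) = ofᵗ (f p)
  Reflects-map f g (ofᶠ ¬p) = ofᶠ (λ q → ¬p (g q))

  lt-reflects : ∀ x y → Reflects (x < y) (lt x y)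
  lt-reflects x y with compare x y
  ... | tri< x<y _ _ = ofᵗ x<y
  ... | tri≈ x≮y _ _ = ofᶠ x≮y
  ... | tri> x≮y _ _ = ofᶠ x≮y

  not-reflects : ∀ {P b} → Reflects P b → Reflects (¬ P) (not b)
  not-reflects (ofᵗ p) = ofᶠ (λ ¬p → ¬p p)
  not-reflects (ofᶠ ¬p) = ofᵗ ¬p

  &-reflects : ∀ {P Q a b} → Reflects P a → Reflects Q b → Reflects (P × Q) (a & b)
  &-reflects (ofᵗ p) (ofᵗ q) = ofᵗ (p , q)
  &-reflects (ofᵗ p) (ofᶠ ¬q) = ofᶠ (λ pq → ¬q (proj₂ pq))
  &-reflects (ofᶠ ¬p) _ = ofᶠ (λ pq → ¬p (proj₁ pq))

  ≺-reflects : ∀ K I → Reflects (K ≺ I) (lt (left K) (left I) & lt (right K) (right I))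
  ≺-reflects K I = &-reflects (lt-reflects _ _) (lt-reflects _ _)

  incl-reflects : ∀ {K I} → Nonempty K → Reflects (K ⊆I I) (incl (finI K) (left I) (right I))
  incl-reflects neK =
    Reflects-map (λ (ℓ≮ℓ′ , r′≮r) → bounds⇒⊆I (≮⇒≥ ℓ≮ℓ′) (≮⇒≥ r′≮r))
                 (λ K⊆I → let (ℓ≤ℓ′ , r′≤r) = ⊆I⇒bounds neK K⊆I
                          in (λ ℓ′<ℓ → <⇒≱ ℓ′<ℓ ℓ≤ℓ′) , (λ r<r′ → <⇒≱ r<r′ r′≤r))
                 (&-reflects (not-reflects (lt-reflects _ _)) (not-reflects (lt-reflects _ _)))

  dropWhile≺ : Interval A → List (Interval A) → List (Interval A)
  dropWhile≺ I [] = []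
  dropWhile≺ I (K ∷ R) with lt (left K) (left I) & lt (right K) (right I)
  ... | tt = dropWhile≺ I R
  ... | ff = K ∷ R

  Head¬≺ : Interval A → List (Interval A) → Set
  Head¬≺ I [] = ⊤
  Head¬≺ I (K ∷ _) = ¬ K ≺ I

  dropWhile≺-head : ∀ I R → Head¬≺ I (dropWhile≺ I R)
  dropWhile≺-head I [] = _
  dropWhile≺-head I (K ∷ R) with lt (left K) (left I) & lt (right K) (right I) | ≺-reflects K I
  ... | _ | ofᵗ _ = dropWhile≺-head I R
  ... | _ | ofᶠ K⊀I = K⊀I

  dropWhile≺-⊆ : ∀ {I J} R → J ∈ dropWhile≺ I R → J ∈ R
  dropWhile≺-⊆ {I} (K ∷ R) J∈R′ with lt (left K) (left I) & lt (right K) (right I)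
  ... | tt = there (dropWhile≺-⊆ R J∈R′)
  ... | ff = J∈R′

  dropWhile≺-keeps : ∀ {I J R} → J ∈ R → ¬ J ≺ I → J ∈ dropWhile≺ I R
  dropWhile≺-keeps {I} {R = K ∷ R} J∈R J⊀I
    with lt (left K) (left I) & lt (right K) (right I) | ≺-reflects K I
  ... | _ | ofᶠ _ = J∈R
  ... | _ | ofᵗ K≺I with J∈R
  ...   | here refl = ⊥-elim (J⊀I K≺I)
  ...   | there J∈R′ = dropWhile≺-keeps J∈R′ J⊀I

  dropWhile≺-increasing : ∀ {I R} → Increasing R → Increasing (dropWhile≺ I R)
  dropWhile≺-increasing [] = []
  dropWhile≺-increasing {I} {K ∷ R} (K≺R ∷ incR) with lt (left K) (left I) & lt (right K) (right I)
  ... | tt = dropWhile≺-increasing incR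
  ... | ff = K≺R ∷ incR

  current : List (Interval A) → Cur
  current [] = nothing
  current (K ∷ _) = finI K

  -- R lists the current interval of S followed by the unread ones; [] once S is exhausted.
  state : List (Interval A) → List (Interval A) → State
  state ms R = st ms (current R) (drop 1 R)

  advance-state : ∀ I R →
    advance (left I) (right I) (current R) (drop 1 R)
      ≡ (current (dropWhile≺ I R) , drop 1 (dropWhile≺ I R))
  advance-state I [] = refl
  advance-state I (K ∷ R) with lt (left K) (left I) & lt (right K) (right I)
  advance-state I (K ∷ []) | tt = refl
  advance-state I (K ∷ J ∷ R) | tt = advance-state I (J ∷ R)
  advance-state I (K ∷ R) | ff = refl

  next-∷ : ∀ I ms R → let R′ = dropWhile≺ I R in
    next (state (I ∷ ms) R)
      ≡ decide I (exhausted (current R′)) (incl (current R′) (left I) (right I))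
               (state ms R′) (next (state ms R′))
  next-∷ I ms R = cong outerStep (advance-state I R)
    where
    outerStep : Cur × List (Interval A) → Maybe (Interval A × State)
    outerStep (c , rs) = decide I (exhausted c) (incl c (left I) (right I)) (st ms c rs) (nextL ms c rs)

  -- The sentinel [-∞..-∞] is always read past, so S can be loaded eagerly.
  next-init : ∀ M S → next (initState M S) ≡ next (state M S)
  next-init [] S = refl
  next-init (I ∷ ms) [] = refl
  next-init (I ∷ ms) (J ∷ S) = refl

  Returns-cong : ∀ {s s′ Is} → next s ≡ next s′ → Returns s′ Is → Returns s Is
  Returns-cong eq (stop e) = stop (trans eq e)
  Returns-cong eq (step e r) = step (trans eq e) r

  module Correctness (S : List (Interval A)) (S-nonempty : All Nonempty S) where

    Removed : Interval A → Set
    Removed I = ∃ λ J → (J ∈ S) × (J ⊆I I)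

    record Invariant (ms R : List (Interval A)) : Set where
      field
        increasing : Increasing R
        ⊆S         : ∀ {J} → J ∈ R → J ∈ S
        complete   : ∀ {J I} → J ∈ S → I ∈ ms → J ⊆I I → J ∈ R
    open Invariant

    invariant-init : ∀ {M} → Increasing S → Invariant M S
    invariant-init incS = record { increasing = incS ; ⊆S = λ J∈S → J∈S ; complete = λ J∈S _ _ → J∈S }

    invariant-tail : ∀ {I ms R} → Invariant (I ∷ ms) R → Invariant ms R
    invariant-tail inv = record
      { increasing = increasing inv ; ⊆S = ⊆S inv ; complete = λ J∈S I∈ms → complete inv J∈S (there I∈ms) }

    invariant-dropWhile≺ : ∀ {I ms R} → All (λ I′ → left I < left I′) ms →
      Invariant (I ∷ ms) R → Invariant (I ∷ ms) (dropWhile≺ I R)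
    invariant-dropWhile≺ {I} {ms} {R} I<ms inv = record
      { increasing = dropWhile≺-increasing (increasing inv)
      ; ⊆S = λ J∈R′ → ⊆S inv (dropWhile≺-⊆ R J∈R′)
      ; complete = λ J∈S I′∈ms J⊆I′ →
          dropWhile≺-keeps (complete inv J∈S I′∈ms J⊆I′)
            (λ (ℓ′<ℓ , _) → <⇒≱ ℓ′<ℓ
               (≤-trans (left-≤ I′∈ms) (proj₁ (⊆I⇒bounds (All.lookup S-nonempty J∈S) J⊆I′))))
      }
      where
      left-≤ : ∀ {I′} → I′ ∈ I ∷ ms → left I ≤ left I′
      left-≤ (here refl) = inj₂ refl
      left-≤ (there I′∈ms) = inj₁ (All.lookup I<ms I′∈ms)

    head-⊈⇒¬Removed : ∀ {I ms K R} → Invariant (I ∷ ms) (K ∷ R) →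
      ¬ K ≺ I → ¬ K ⊆I I → ¬ Removed I
    head-⊈⇒¬Removed {K = K} inv K⊀I K⊈I (J , J∈S , J⊆I) with complete inv J∈S (here refl) J⊆I | increasing inv
    ... | here refl | _ = K⊈I J⊆I
    ... | there J∈R | K≺R ∷ _ =
      <⇒≱ (≤-<-trans (¬≺-⊈⇒right≤ neK K⊀I K⊈I) (proj₂ (All.lookup K≺R J∈R)))
          (proj₂ (⊆I⇒bounds (All.lookup S-nonempty J∈S) J⊆I))
      where
      neK : Nonempty K
      neK = All.lookup S-nonempty (⊆S inv (here refl))

    decide-spec : ∀ I ms R → Invariant (I ∷ ms) R → Head¬≺ I R →
      let s = state ms R
          d = decide I (exhausted (current R)) (incl (current R) (left I) (right I)) s (next s)
      in (¬ Removed I × d ≡ just (I , s)) ⊎ (Removed I × d ≡ next s)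
    decide-spec I ms [] inv _ =
      inj₁ ((λ (J , J∈S , J⊆I) → ¬Any[] (complete inv J∈S (here refl) J⊆I)) , refl)
    decide-spec I ms (K ∷ R) inv K⊀I
      with incl (finI K) (left I) (right I)
         | incl-reflects {K} {I} (All.lookup S-nonempty (⊆S inv (here refl)))
    ... | _ | ofᵗ K⊆I = inj₂ ((K , ⊆S inv (here refl) , K⊆I) , refl)
    ... | _ | ofᶠ K⊈I = inj₁ (head-⊈⇒¬Removed inv K⊀I K⊈I , refl)

    Enumerates : List (Interval A) → State → Set
    Enumerates ms s = Σ (List (Interval A)) λ Is →
      Returns s Is × Unique Is × (∀ I → (I ∈ Is) ⇔ I ∈Diff ms , S)

    enumerates-emit : ∀ {I ms s s′} → All (λ K → left I < left K) ms → ¬ Removed I →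
      next s ≡ just (I , s′) → Enumerates ms s′ → Enumerates (I ∷ ms) s
    enumerates-emit {I} {ms} I<ms notRemoved eq (Is , ret , uniq , spec) =
      I ∷ Is , step eq ret , All.tabulate I≢ ∷ uniq , λ K → mk⇔ to from
      where
      I≢ : ∀ {K} → K ∈ Is → I ≢ K
      I≢ K∈Is refl = irrefl refl (All.lookup I<ms (proj₁ (Equivalence.to (spec I) K∈Is)))
      to : ∀ {K} → K ∈ I ∷ Is → K ∈Diff I ∷ ms , S
      to (here refl) = here refl , notRemoved
      to {K} (there K∈Is) = let (K∈ms , K-kept) = Equivalence.to (spec K) K∈Is in there K∈ms , K-kept
      from : ∀ {K} → K ∈Diff I ∷ ms , S → K ∈ I ∷ Is
      from (here refl , _) = here refl
      from {K} (there K∈ms , K-kept) = there (Equivalence.from (spec K) (K∈ms , K-kept))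

    enumerates-skip : ∀ {I ms s s′} → Removed I → next s ≡ next s′ → Enumerates ms s′ → Enumerates (I ∷ ms) s
    enumerates-skip {I} {ms} removed eq (Is , ret , uniq , spec) =
      Is , Returns-cong eq ret , uniq , λ K → mk⇔ (to K) (from K)
      where
      to : ∀ K → K ∈ Is → K ∈Diff I ∷ ms , S
      to K K∈Is = let (K∈ms , K-kept) = Equivalence.to (spec K) K∈Is in there K∈ms , K-kept
      from : ∀ K → K ∈Diff I ∷ ms , S → K ∈ Is
      from K (here refl , I-kept) = ⊥-elim (I-kept removed)
      from K (there K∈ms , K-kept) = Equivalence.from (spec K) (K∈ms , K-kept)

    enumerates : ∀ {ms} → AllPairs (λ I J → left I < left J) ms →
      ∀ {R} → Invariant ms R → Enumerates ms (state ms R)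
    enumerates [] _ = [] , stop refl , [] , λ I → mk⇔ (λ ()) (λ ())
    enumerates {I ∷ ms} (I<ms ∷ ms-ascending) {R} inv =
      [ (λ (notRemoved , eq) → enumerates-emit I<ms notRemoved (trans (next-∷ I ms R) eq) rest)
      , (λ (removed , eq) → enumerates-skip removed (trans (next-∷ I ms R) eq) rest)
      ]′ (decide-spec I ms (dropWhile≺ I R) inv′ (dropWhile≺-head I R))
      where
      inv′ : Invariant (I ∷ ms) (dropWhile≺ I R)
      inv′ = invariant-dropWhile≺ I<ms inv
      rest : Enumerates ms (state ms (dropWhile≺ I R))
      rest = enumerates ms-ascending (invariant-tail inv′)

mainTheorem12 : (A : Set) (_<_ : A → A → Set) (sto : IsStrictTotalOrder _≡_ _<_) →
    Finite A →
    (M S : List (Interval A)) → M ≢ [] → S ≢ [] →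
    Alg.IsAntichain _<_ sto M → Alg.IsAntichain _<_ sto S →
    Σ (List (Interval A)) λ Is →
      Alg.Returns _<_ sto (Alg.initState _<_ sto M S) Is
      × Unique Is
      × (∀ I → (I ∈ Is) ⇔ Alg._∈Diff_,_ _<_ sto I M S)
mainTheorem12 A _<_ sto _ M S _ _ (_ , _ , M-ascending) S-antichain@(S-nonempty , _) =
  let (Is , ret , uniq , spec) =
        enumerates M-ascending (invariant-init (antichain⇒increasing S-antichain))
  in Is , Returns-cong (next-init M S) ret , uniq , spec
  where
  open BrouwerianDifference _<_ sto
  open Correctness S S-nonempty
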